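{- Let $k\ge2$ and let $A[0..n)$ be an array of $n\ge1$ elements. When $k$-way Powersort (stack-based implementation, as in the context) is run on $A$, the run stack $S$ never contains more than $(k-1)\lceil\log_k(n)+1\rceil$ entries.
   Context: Runs: the array is partitioned left to right into maximal contiguous segments that are weakly increasing or strictly decreasing (the runs $R_0,\dots,R_{r-1}$, lengths $L_0,\dots,L_{r-1}$). For $1\le i<r$ let $B_i$ be the boundary between $R_{i-1}$ and $R_i$, $\ell_i=L_i/n$, $a_i=\sum_{j=0}^{i-1}\ell_j-\tfrac12\ell_{i-1}$, $b_i=\sum_{j=0}^{i-1}\ell_j+\tfrac12\ell_i$, and the power $P_i=\min\{p\in\mathbb N:\lfloor a_i k^p\rfloor<\lfloor b_i k^p\rfloor\}$. Stack-based $k$-way Powersort: maintain a stack $S$ of pairs (sorted segment, power), with powers weakly increasing from bottom to top, and a current segment $X$ initially $R_0$. For $i=1,\dots,r-1$: compute $P=P_i$ (power of the boundary between $X$'s last run $R_{i-1}$ and $R_i$); while the top of $S$ has power $>P$: let $P'$ be the top's power, pop all consecutive top entries with power equal to $P'$, and merge them together with $X$ into a new $X$; then push $(X,P)$ onto $S$ and set $X=R_i$. Finally, repeatedly pop up to $k-1$ entries from $S$ and merge them with $X$ into a new $X$ until $S$ is empty. -}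

module Defs where

open import Level using (Level)
open import Data.Nat using (ℕ; zero; suc; _+_; _*_; _∸_; _^_; _≤_; _<_; _≤?_; _<?_; _≡ᵇ_; _<ᵇ_)
open import Data.Nat.DivMod using (_/_)
open import Data.Bool using (Bool; true; false; if_then_else_)
open import Data.List using (List; []; _∷_; length; _++_; concat; map; sum; take; drop; reverse)
open import Data.Product using (_×_; _,_; proj₁; proj₂)
open import Relation.Nullary using (yes; no)
open import Relation.Binary.Bundles using (DecTotalOrder)

-- ⌈log_k n⌉ : the least c with n ≤ k^c  (searched for c = 0,1,…,n;
-- for k ≥ 2 one has n ≤ k^n, so the search always succeeds).
ceilLogSearch : ℕ → ℕ → ℕ → ℕ → ℕ
ceilLogSearch k n zero    c = c
ceilLogSearch k n (suc f) c with n ≤? k ^ c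
... | yes _ = c
... | no  _ = ceilLogSearch k n f (suc c)

ceilLog : ℕ → ℕ → ℕ
ceilLog k n = ceilLogSearch k n (suc n) 0

-- The bound (k-1) ⌈log_k(n) + 1⌉ = (k-1) (⌈log_k n⌉ + 1).
stackBound : ℕ → ℕ → ℕ
stackBound k n = (k ∸ 1) * (ceilLog k n + 1)

-- With s = L_0+…+L_{i-1}, Lp = L_{i-1}, Lc = L_i:
--   a_i = (2s - Lp)/(2n),  b_i = (2s + Lc)/(2n),
--   ⌊a_i k^p⌋ = ((2s - Lp) k^p) div (2n),  ⌊b_i k^p⌋ = ((2s + Lc) k^p) div (2n).
-- P_i = least p with ⌊a_i k^p⌋ < ⌊b_i k^p⌋, searched for p = 0,1,…,n
-- (since Lp, Lc ≥ 1 and k^n ≥ n, p = n always qualifies).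
powerSearch : (k m s Lp Lc : ℕ) → ℕ → ℕ → ℕ
powerSearch k m s Lp Lc zero    p = p
powerSearch k m s Lp Lc (suc f) p with
  ((2 * s ∸ Lp) * k ^ p) / (2 * suc m) <? ((2 * s + Lc) * k ^ p) / (2 * suc m)
... | yes _ = p
... | no  _ = powerSearch k m s Lp Lc f (suc p)

boundaryPower : (k n s Lp Lc : ℕ) → ℕ
boundaryPower k zero    s Lp Lc = 0
boundaryPower k (suc m) s Lp Lc = powerSearch k m s Lp Lc (suc (suc m)) 0

module Powersort {c ℓ₁ ℓ₂ : Level} (O : DecTotalOrder c ℓ₁ ℓ₂) where
  open DecTotalOrder O using (totalOrder) renaming (Carrier to A; _≤?_ to _≼?_)
  open import Data.List.Sort.MergeSort O using (mergeSort)
  open import Data.List.Sort.Base totalOrder using (SortingAlgorithm)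

  sortL : List A → List A
  sortL = SortingAlgorithm.sort mergeSort

  incr : A → List A → List A × List A
  incr x [] = [] , []
  incr x (y ∷ ys) with x ≼? y
  ... | yes _ = let r = incr y ys in (y ∷ proj₁ r) , proj₂ r
  ... | no  _ = [] , (y ∷ ys)

  -- decr x ys : same for a strictly decreasing run (y < x ⇔ ¬ x ≤ y).
  decr : A → List A → List A × List A
  decr x [] = [] , []
  decr x (y ∷ ys) with x ≼? y
  ... | yes _ = [] , (y ∷ ys)
  ... | no  _ = let r = decr y ys in (y ∷ proj₁ r) , proj₂ r

  runsF : ℕ → List A → List (List A)
  runsF zero    xs = []
  runsF (suc f) [] = []
  runsF (suc f) (x ∷ []) = (x ∷ []) ∷ []
  runsF (suc f) (x ∷ y ∷ ys) with x ≼? y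
  ... | yes _ = let r = incr y ys in (x ∷ y ∷ proj₁ r) ∷ runsF f (proj₂ r)
  ... | no  _ = let r = decr y ys in (x ∷ y ∷ proj₁ r) ∷ runsF f (proj₂ r)

  runs : List A → List (List A)
  runs xs = runsF (length xs) xs

  -- Stack entries: (sorted segment, power); the head of the list is the top.
  Entry : Set c
  Entry = List A × ℕ

  Stack : Set c
  Stack = List Entry

  merge : List (List A) → List A
  merge segs = sortL (concat segs)

  popEq : ℕ → Stack → List (List A) × Stack
  popEq q [] = [] , []
  popEq q ((Y , q') ∷ S) with q ≡ᵇ q'
  ... | true  = let r = popEq q S in (Y ∷ proj₁ r) , proj₂ r
  ... | false = [] , ((Y , q') ∷ S)

  -- while top power > P : pop the group of equal top powers, merge with X.
  -- Returns (final stack, final X, list of all intermediate stacks).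
  collapse : ℕ → ℕ → Stack → List A → Stack × List A × List Stack
  collapse zero    P S X = S , X , []
  collapse (suc f) P [] X = [] , X , []
  collapse (suc f) P ((Y , q) ∷ S) X with P <ᵇ q
  ... | false = ((Y , q) ∷ S) , X , []
  ... | true  =
    let g   = popEq q S
        X'  = merge (reverse (Y ∷ proj₁ g) ++ (X ∷ []))
        rec = collapse f P (proj₂ g) X'
    in proj₁ rec , proj₁ (proj₂ rec) , (proj₂ g ∷ proj₂ (proj₂ rec))

  finalPhase : ℕ → ℕ → Stack → List A → List Stack
  finalPhase k zero    S X = []
  finalPhase k (suc f) [] X = []
  finalPhase k (suc f) (e ∷ S) X =
    let popped = take (k ∸ 1) (e ∷ S)
        rest   = drop (k ∸ 1) (e ∷ S)
        X'     = merge (reverse (map proj₁ popped) ++ (X ∷ []))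
    in rest ∷ finalPhase k f rest X'

  -- Main loop over boundaries i = 1,…,r-1.
  -- Arguments: k, n, s = L_0+…+L_{i-1}, stack, X, last run R_{i-1},
  -- remaining runs R_i, R_{i+1}, ….
  mainLoop : ℕ → ℕ → ℕ → Stack → List A → List A → List (List A) → List Stack
  mainLoop k n s S X Rprev [] = finalPhase k (length S) S X
  mainLoop k n s S X Rprev (Ri ∷ Rs) =
    let P   = boundaryPower k n s (length Rprev) (length Ri)
        col = collapse (length S) P S X
        S'  = (proj₁ (proj₂ col) , P) ∷ proj₁ col
    in proj₂ (proj₂ col) ++ (S' ∷ mainLoop k n (s + length Ri) S' Ri Ri Rs)

  -- All states the run stack S goes through (starting with the empty stack)
  -- when stack-based k-way Powersort runs on the array xs.
  stackTrace : ℕ → List A → List Stack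
  stackTrace k xs with runs xs
  ... | []        = [] ∷ []
  ... | R0 ∷ Rs   = [] ∷ mainLoop k (length xs) (length R0) [] R0 R0 Rs

-- Write N = 2n and s = L₀ + ⋯ + L_{i-1}. Then a_i = (2s − L_{i-1}) / N and b_i = (2s + L_i) / N = a_{i+1},
-- and the power of B_i is the least level p at which a_i and b_i lie in different cells of the
-- subdivision of [0, 1) into k^p equal parts. As b_i − a_i ≥ 1/n ≥ k^(−⌈log_k n⌉), every power is at
-- most C = ⌈log_k n⌉.
-- While the current point is a_i, the stack holds, for every level q, at most as many entries of power q
-- as the q-th base-k digit of a_i. Pushing power P preserves this: all entries of power above P were
-- just popped, the cells of a_i and a_{i+1} agree on the levels below P, so those digits do not change,
-- and inside the common level-(P−1) cell the level-P cell moves to the right, so digit P grows.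
-- Digits are below k and the level-0 digit of a point of [0, 1) is 0, so the stack never has more than
-- (k − 1)(C + 1) entries.

{-# OPTIONS --safe #-}
module Submission where

open import Defs
open import Level using (Level)
open import Function using (_∘_)
open import Data.Empty using (⊥-elim)
open import Data.Bool using (true; false; T)
open import Data.Nat
open import Data.Nat.Properties
open import Data.Nat.DivMod
open import Data.Nat.ListAction using (sum)
open import Data.List using (List; []; _∷_; length; map; filter; take; drop; reverse; _++_)
open import Data.List.Properties using (length-map; filter-accept; filter-reject; filter-none)
open import Data.List.Relation.Unary.All using (All; []; _∷_)
import Data.List.Relation.Unary.All as All
open import Data.List.Relation.Unary.All.Properties using (all-filter; ++⁺) renaming (filter⁺ to All-filter⁺)
open import Data.List.Relation.Unary.AllPairs using (AllPairs; []; _∷_)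
open import Data.List.Relation.Binary.Sublist.Propositional using (_⊆_; []; _∷_; _∷ʳ_; ⊆-refl; ⊆-trans)
open import Data.List.Relation.Binary.Sublist.Propositional.Properties
  using (length-mono-≤; filter-⊆; filter⁺; drop-⊆; map⁺; All-resp-⊆)
open import Data.Product using (_×_; _,_; proj₁; proj₂)
open import Relation.Nullary using (yes; no; ¬_)
open import Relation.Unary using (Pred; Decidable)
open import Relation.Unary.Properties using (∁?)
open import Relation.Binary using (tri<; tri≈; tri>)
open import Relation.Binary.Bundles using (DecTotalOrder)
open import Relation.Binary.PropositionalEquality

length-filter+length-filter-∁ : ∀ {a p} {A : Set a} {P : Pred A p} (P? : Decidable P) xs →
  length (filter P? xs) + length (filter (∁? P?) xs) ≡ length xs
length-filter+length-filter-∁ P? [] = refl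
length-filter+length-filter-∁ P? (x ∷ xs) with P? x
... | yes _ = cong suc (length-filter+length-filter-∁ P? xs)
... | no  _ = trans (+-suc _ _) (cong suc (length-filter+length-filter-∁ P? xs))

count : ℕ → List ℕ → ℕ
count q = length ∘ filter (_≟ q)

count-mono : ∀ q {xs ys} → xs ⊆ ys → count q xs ≤ count q ys
count-mono q xs⊆ys = length-mono-≤ (filter⁺ (_≟ q) (_≟ q) (λ { refl p≡q → p≡q }) xs⊆ys)

count≤⇒length≤ : ∀ K c ps → All (_< c) ps → (∀ q → count q ps ≤ K) → length ps ≤ K * c
count≤⇒length≤ K zero    []      _        _       = z≤n
count≤⇒length≤ K zero    (_ ∷ _) (() ∷ _) _
count≤⇒length≤ K (suc c) ps      ps<1+c   count≤K = begin
  length ps                       ≡⟨ sym (length-filter+length-filter-∁ (_≟ c) ps) ⟩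
  count c ps + length rest        ≤⟨ +-mono-≤ (count≤K c) (count≤⇒length≤ K c rest rest<c count-rest≤K) ⟩
  K + K * c                       ≡⟨ sym (*-suc K c) ⟩
  K * suc c                       ∎
  where
  open ≤-Reasoning
  rest : List ℕ
  rest = filter (∁? (_≟ c)) ps
  rest<c : All (_< c) rest
  rest<c = All.zipWith (λ (p<1+c , p≢c) → ≤∧≢⇒< (≤-pred p<1+c) p≢c)
             (All-filter⁺ (∁? (_≟ c)) ps<1+c , all-filter (∁? (_≟ c)) ps)
  count-rest≤K : ∀ q → count q rest ≤ K
  count-rest≤K q = ≤-trans (count-mono q (filter-⊆ (∁? (_≟ c)) ps)) (count≤K q)

n<k^n : ∀ {k} → 1 < k → ∀ n → n < k ^ n
n<k^n 1<k zero    = s≤s z≤n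
n<k^n 1<k (suc n) = ≤-<-trans (n<k^n 1<k n) (^-monoʳ-< _ 1<k (n<1+n n))

ceilLogSearch-spec : ∀ k n f c d → c ≤ d → d < c + f → n ≤ k ^ d →
  let r = ceilLogSearch k n f c in r ≤ d × n ≤ k ^ r
ceilLogSearch-spec k n zero    c d c≤d d<c+0 _ = ⊥-elim (<⇒≱ (subst (d <_) (+-identityʳ c) d<c+0) c≤d)
ceilLogSearch-spec k n (suc f) c d c≤d d<c+1+f n≤k^d with n ≤? k ^ c
... | yes n≤k^c = c≤d , n≤k^c
... | no  n≰k^c = ceilLogSearch-spec k n f (suc c) d (≤∧≢⇒< c≤d λ { refl → n≰k^c n≤k^d })
                    (subst (d <_) (+-suc c f) d<c+1+f) n≤k^d

ceilLog-spec : ∀ {k} → 1 < k → ∀ n → ceilLog k n ≤ n × n ≤ k ^ ceilLog k n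
ceilLog-spec 1<k n = ceilLogSearch-spec _ n (suc n) 0 n z≤n (n<1+n n) (<⇒≤ (n<k^n 1<k n))

AllPairs-resp-⊆ : ∀ {a r} {A : Set a} {R : A → A → Set r} {xs ys : List A} →
                  xs ⊆ ys → AllPairs R ys → AllPairs R xs
AllPairs-resp-⊆ []         []         = []
AllPairs-resp-⊆ (_ ∷ʳ τ)   (_ ∷ rys)  = AllPairs-resp-⊆ τ rys
AllPairs-resp-⊆ (refl ∷ τ) (Ry ∷ rys) = All-resp-⊆ τ Ry ∷ AllPairs-resp-⊆ τ rys

module KaryCells (k N : ℕ) {{_ : NonZero k}} {{_ : NonZero N}} where

  private instance
    N*k≢0 : NonZero (N * k)
    N*k≢0 = m*n≢0 N k

  cell : ℕ → ℕ → ℕ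
  cell j z = z * k ^ j / N

  cell-mono : ∀ j {x y} → x ≤ y → cell j x ≤ cell j y
  cell-mono j x≤y = /-monoˡ-≤ N (*-monoˡ-≤ (k ^ j) x≤y)

  cell[1+j]/k≡cell[j] : ∀ j z → cell (suc j) z / k ≡ cell j z
  cell[1+j]/k≡cell[j] j z = begin
    z * (k * k ^ j) / N / k   ≡⟨ m/n/o≡m/[n*o] (z * (k * k ^ j)) N k ⟩
    z * (k * k ^ j) / (N * k) ≡⟨ cong (_/ (N * k)) reorder ⟩
    z * k ^ j * k / (N * k)   ≡⟨ m*n/o*n≡m/o (z * k ^ j) k N ⟩
    cell j z                  ∎
    where
    open ≡-Reasoning
    reorder : z * (k * k ^ j) ≡ z * k ^ j * k
    reorder = trans (cong (z *_) (*-comm k (k ^ j))) (sym (*-assoc z (k ^ j) k))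

  k*cell[j]≤cell[1+j] : ∀ j z → k * cell j z ≤ cell (suc j) z
  k*cell[j]≤cell[1+j] j z = begin
    k * cell j z               ≡⟨ cong (k *_) (sym (cell[1+j]/k≡cell[j] j z)) ⟩
    k * (cell (suc j) z / k)   ≡⟨ *-comm k _ ⟩
    (cell (suc j) z / k) * k   ≤⟨ m/n*n≤m (cell (suc j) z) k ⟩
    cell (suc j) z             ∎
    where open ≤-Reasoning

  cell[1+j]<k*cell[j]+k : ∀ j z → cell (suc j) z < k * cell j z + k
  cell[1+j]<k*cell[j]+k j z = begin-strict
    w                   ≡⟨ m≡m%n+[m/n]*n w k ⟩
    w % k + (w / k) * k <⟨ +-monoˡ-< ((w / k) * k) (m%n<n w k) ⟩
    k + (w / k) * k     ≡⟨ cong (λ t → k + t * k) (cell[1+j]/k≡cell[j] j z) ⟩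
    k + cell j z * k    ≡⟨ +-comm k _ ⟩
    cell j z * k + k    ≡⟨ cong (_+ k) (*-comm (cell j z) k) ⟩
    k * cell j z + k    ∎
    where
    open ≤-Reasoning
    w : ℕ
    w = cell (suc j) z

  cell[x]<cell[x+d] : ∀ j x d → N ≤ d * k ^ j → cell j x < cell j (x + d)
  cell[x]<cell[x+d] j x d N≤d*k^j = begin-strict
    cell j x                      <⟨ n<1+n _ ⟩
    1 + x * k ^ j / N             ≡⟨ cong (λ t → 1 + t / N) (sym (m+n∸n≡m (x * k ^ j) N)) ⟩
    1 + (x * k ^ j + N ∸ N) / N   ≡⟨ sym (m/n≡1+[m∸n]/n (m≤n+m N _)) ⟩
    (x * k ^ j + N) / N           ≤⟨ /-monoˡ-≤ N (+-monoʳ-≤ (x * k ^ j) N≤d*k^j) ⟩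
    (x * k ^ j + d * k ^ j) / N   ≡⟨ cong (_/ N) (sym (*-distribʳ-+ (k ^ j) x d)) ⟩
    cell j (x + d)                ∎
    where open ≤-Reasoning

  -- cell q z ∸ siblingBase q z is the q-th digit of z / N in base k.
  siblingBase : ℕ → ℕ → ℕ
  siblingBase zero    z = 0
  siblingBase (suc q) z = k * cell q z

  siblingBase≤cell : ∀ q z → siblingBase q z ≤ cell q z
  siblingBase≤cell zero    z = z≤n
  siblingBase≤cell (suc q) z = k*cell[j]≤cell[1+j] q z

module Levels (k' m : ℕ) where

  k n N C : ℕ
  k = 2 + k'
  n = suc m
  N = 2 * n
  C = ceilLog k n

  open KaryCells k N public

  C≤n : C ≤ n
  C≤n = proj₁ (ceilLog-spec (s≤s (s≤s z≤n)) n)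

  n≤k^C : n ≤ k ^ C
  n≤k^C = proj₂ (ceilLog-spec (s≤s (s≤s z≤n)) n)

  record FirstSplit (x y P : ℕ) : Set where
    field
      splits     : cell P x < cell P y
      agreeBelow : ∀ j → j < P → cell j x ≡ cell j y

  -- With s = L₀ + ⋯ + L_{i-1}, Lp = L_{i-1} and Lc = L_i, the points x / N and y / N are a_i and b_i.
  module _ (s Lp Lc : ℕ) where
    private
      x y : ℕ
      x = 2 * s ∸ Lp
      y = 2 * s + Lc

    powerSearch-spec : ∀ f p d → p ≤ d → d < p + f → cell d x < cell d y →
      let r = powerSearch k m s Lp Lc f p in
      r ≤ d × cell r x < cell r y × (∀ j → p ≤ j → j < r → ¬ cell j x < cell j y)
    powerSearch-spec zero    p d p≤d d<p+0 _ = ⊥-elim (<⇒≱ (subst (d <_) (+-identityʳ p) d<p+0) p≤d)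
    powerSearch-spec (suc f) p d p≤d d<p+1+f splits-d with cell p x <? cell p y
    ... | yes splits-p = p≤d , splits-p , λ j p≤j j<p → ⊥-elim (<⇒≱ j<p p≤j)
    ... | no ¬splits-p
      with r≤d , splits-r , below ← powerSearch-spec f (suc p) d
             (≤∧≢⇒< p≤d λ { refl → ¬splits-p splits-d }) (subst (d <_) (+-suc p f) d<p+1+f) splits-d
      = r≤d , splits-r , not-below
      where
      not-below : ∀ j → p ≤ j → j < _ → ¬ cell j x < cell j y
      not-below j p≤j j<r with p ≟ j
      ... | yes refl = ¬splits-p
      ... | no  p≢j  = below j (≤∧≢⇒< p≤j p≢j) j<r

    boundaryPower-spec : 1 ≤ Lp → Lp ≤ 2 * s → 1 ≤ Lc →
      let P = boundaryPower k n s Lp Lc in P ≤ C × FirstSplit x y P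
    boundaryPower-spec 1≤Lp Lp≤2s 1≤Lc = P≤C , record { splits = splits-P ; agreeBelow = agree }
      where
      y≡x+[Lp+Lc] : y ≡ x + (Lp + Lc)
      y≡x+[Lp+Lc] = begin
        2 * s + Lc        ≡⟨ cong (_+ Lc) (sym (m∸n+n≡m Lp≤2s)) ⟩
        (x + Lp) + Lc     ≡⟨ +-assoc x Lp Lc ⟩
        x + (Lp + Lc)     ∎
        where open ≡-Reasoning
      x≤y : x ≤ y
      x≤y = subst (x ≤_) (sym y≡x+[Lp+Lc]) (m≤m+n x _)
      N≤[Lp+Lc]*k^C : N ≤ (Lp + Lc) * k ^ C
      N≤[Lp+Lc]*k^C = ≤-trans (*-monoʳ-≤ 2 n≤k^C) (*-monoˡ-≤ (k ^ C) (+-mono-≤ 1≤Lp 1≤Lc))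
      splits-C : cell C x < cell C y
      splits-C = subst (λ t → cell C x < cell C t) (sym y≡x+[Lp+Lc]) (cell[x]<cell[x+d] C x (Lp + Lc) N≤[Lp+Lc]*k^C)
      P : ℕ
      P = boundaryPower k n s Lp Lc
      search : P ≤ C × cell P x < cell P y × (∀ j → 0 ≤ j → j < P → ¬ cell j x < cell j y)
      search = powerSearch-spec (suc n) 0 C z≤n (s≤s C≤n) splits-C
      P≤C : P ≤ C
      P≤C = proj₁ search
      splits-P : cell P x < cell P y
      splits-P = proj₁ (proj₂ search)
      agree : ∀ j → j < P → cell j x ≡ cell j y
      agree j j<P = ≤-antisym (cell-mono j x≤y) (≮⇒≥ (proj₂ (proj₂ search) j z≤n j<P))

  record StackInv (ps : List ℕ) (z : ℕ) : Set where
    field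
      sorted  : AllPairs _≥_ ps
      bounded : All (_≤ C) ps
      counted : ∀ q → count q ps + siblingBase q z ≤ cell q z

  StackInv-[] : ∀ z → StackInv [] z
  StackInv-[] z = record { sorted = [] ; bounded = [] ; counted = λ q → siblingBase≤cell q z }

  StackInv⇒length≤ : ∀ {ps z} → StackInv ps z → z < N → length ps ≤ stackBound k n
  StackInv⇒length≤ {ps} {z} inv z<N = begin
    length ps           ≤⟨ count≤⇒length≤ (k ∸ 1) (suc C) ps (All.map s≤s bounded) count≤k-1 ⟩
    (k ∸ 1) * suc C     ≡⟨ cong ((k ∸ 1) *_) (+-comm 1 C) ⟩
    stackBound k n      ∎
    where
    open StackInv inv
    open ≤-Reasoning
    count≤k-1 : ∀ q → count q ps ≤ k ∸ 1
    count≤k-1 zero = begin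
      count 0 ps        ≡⟨ sym (+-identityʳ _) ⟩
      count 0 ps + 0    ≤⟨ counted 0 ⟩
      z * 1 / N         ≡⟨ m<n⇒m/n≡0 (subst (_< N) (sym (*-identityʳ z)) z<N) ⟩
      0                 ≤⟨ z≤n ⟩
      k ∸ 1             ∎
    count≤k-1 (suc q) = ≤-pred (+-cancelʳ-< (k * cell q z) (count (suc q) ps) k (begin-strict
      count (suc q) ps + k * cell q z   ≤⟨ counted (suc q) ⟩
      cell (suc q) z                    <⟨ cell[1+j]<k*cell[j]+k q z ⟩
      k * cell q z + k                  ≡⟨ +-comm _ k ⟩
      k + k * cell q z                  ∎))

  siblingBase-agree : ∀ {z z' P} → FirstSplit z z' P → ∀ q → q ≤ P → siblingBase q z ≡ siblingBase q z'
  siblingBase-agree split zero    _   = refl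
  siblingBase-agree split (suc q) q<P = cong (k *_) (FirstSplit.agreeBelow split q q<P)

  StackInv-push : ∀ {ps ps' z z' P} → StackInv ps z → P ≤ C → FirstSplit z z' P →
                  ps' ⊆ ps → All (_≤ P) ps' → StackInv (P ∷ ps') z'
  StackInv-push {ps} {ps'} {z} {z'} {P} inv P≤C split ps'⊆ps ps'≤P = record
    { sorted  = ps'≤P ∷ AllPairs-resp-⊆ ps'⊆ps sorted
    ; bounded = P≤C ∷ All-resp-⊆ ps'⊆ps bounded
    ; counted = counted'
    }
    where
    open StackInv inv
    open FirstSplit split
    open ≤-Reasoning
    counted' : ∀ q → count q (P ∷ ps') + siblingBase q z' ≤ cell q z'
    counted' q with <-cmp q P
    ... | tri< q<P _ _ = begin
      count q (P ∷ ps') + siblingBase q z'  ≡⟨ cong₂ _+_ (cong length (filter-reject (_≟ q) (>⇒≢ q<P)))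
                                                        (sym (siblingBase-agree split q (<⇒≤ q<P))) ⟩
      count q ps' + siblingBase q z         ≤⟨ +-monoˡ-≤ _ (count-mono q ps'⊆ps) ⟩
      count q ps + siblingBase q z          ≤⟨ counted q ⟩
      cell q z                              ≡⟨ agreeBelow q q<P ⟩
      cell q z'                             ∎
    ... | tri≈ _ refl _ = begin
      count q (q ∷ ps') + siblingBase q z'  ≡⟨ cong₂ _+_ (cong length (filter-accept (_≟ q) refl))
                                                        (sym (siblingBase-agree split q ≤-refl)) ⟩
      suc (count q ps' + siblingBase q z)   ≤⟨ s≤s (+-monoˡ-≤ _ (count-mono q ps'⊆ps)) ⟩
      suc (count q ps + siblingBase q z)    ≤⟨ s≤s (counted q) ⟩
      suc (cell q z)                        ≤⟨ splits ⟩
      cell q z'                             ∎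
    ... | tri> _ _ P<q = begin
      count q (P ∷ ps') + siblingBase q z'  ≡⟨ cong (λ t → length t + siblingBase q z')
                                                      (filter-none (_≟ q) (All.map (λ p≤P → <⇒≢ (≤-<-trans p≤P P<q)) (≤-refl ∷ ps'≤P))) ⟩
      siblingBase q z'                      ≤⟨ siblingBase≤cell q z' ⟩
      cell q z'                             ∎

module StackBehaviour {c ℓ₁ ℓ₂ : Level} (O : DecTotalOrder c ℓ₁ ℓ₂) where
  open Powersort O
  open DecTotalOrder O using () renaming (Carrier to A; _≤?_ to _≼?_)

  powers : Stack → List ℕ
  powers = map proj₂

  popEq-⊆ : ∀ q S → proj₂ (popEq q S) ⊆ S
  popEq-⊆ q []             = []
  popEq-⊆ q ((Y , q') ∷ S) with q ≡ᵇ q'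
  ... | true  = _ ∷ʳ popEq-⊆ q S
  ... | false = ⊆-refl

  collapse-spec : ∀ f P S X → length S ≤ f → AllPairs _≥_ (powers S) →
    let (S' , _ , trace) = collapse f P S X in
    S' ⊆ S × All (_≤ P) (powers S') × All (_⊆ S) trace
  collapse-spec zero    P [] X _ _ = [] , [] , []
  collapse-spec (suc f) P [] X _ _ = [] , [] , []
  collapse-spec (suc f) P ((Y , q) ∷ S) X (s≤s |S|≤f) (q≥S ∷ sorted) with P <ᵇ q in P<ᵇq
  ... | false = ⊆-refl , q≤P ∷ All.map (λ p≤q → ≤-trans p≤q q≤P) q≥S , []
    where
    q≤P : q ≤ P
    q≤P = ≮⇒≥ (λ P<q → subst T P<ᵇq (<⇒<ᵇ P<q))
  ... | true
    with S'⊆R , S'≤P , trace⊆R ← collapse-spec f P (proj₂ (popEq q S)) _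
           (≤-trans (length-mono-≤ (popEq-⊆ q S)) |S|≤f)
           (AllPairs-resp-⊆ (map⁺ proj₂ (popEq-⊆ q S)) sorted)
    = ⊆-trans S'⊆R R⊆S , S'≤P , R⊆S ∷ All.map (λ T⊆R → ⊆-trans T⊆R R⊆S) trace⊆R
    where
    R⊆S : proj₂ (popEq q S) ⊆ (Y , q) ∷ S
    R⊆S = _ ∷ʳ popEq-⊆ q S

  finalPhase-⊆ : ∀ k f S X → All (_⊆ S) (finalPhase k f S X)
  finalPhase-⊆ k zero    S       X = []
  finalPhase-⊆ k (suc f) []      X = []
  finalPhase-⊆ k (suc f) (e ∷ S) X =
    R⊆S ∷ All.map (λ T⊆R → ⊆-trans T⊆R R⊆S) (finalPhase-⊆ k f _ X')
    where
    R⊆S : drop (k ∸ 1) (e ∷ S) ⊆ e ∷ S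
    R⊆S = drop-⊆ (k ∸ 1) (e ∷ S)
    X' : List A
    X' = merge (reverse (map proj₁ (take (k ∸ 1) (e ∷ S))) ++ (X ∷ []))

  incr-length : ∀ x ys → length (proj₁ (incr x ys)) + length (proj₂ (incr x ys)) ≡ length ys
  incr-length x []       = refl
  incr-length x (y ∷ ys) with x ≼? y
  ... | yes _ = cong suc (incr-length y ys)
  ... | no  _ = refl

  decr-length : ∀ x ys → length (proj₁ (decr x ys)) + length (proj₂ (decr x ys)) ≡ length ys
  decr-length x []       = refl
  decr-length x (y ∷ ys) with x ≼? y
  ... | yes _ = refl
  ... | no  _ = cong suc (decr-length y ys)

  run∷rest-length≤ : ∀ {a b l t} → a + b ≡ l → t ≤ b → suc (suc a) + t ≤ suc (suc l)
  run∷rest-length≤ {a} a+b≡l t≤b = s≤s (s≤s (≤-trans (+-monoʳ-≤ a t≤b) (≤-reflexive a+b≡l)))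

  runsF-spec : ∀ f xs → All (λ R → 1 ≤ length R) (runsF f xs) × sum (map length (runsF f xs)) ≤ length xs
  runsF-spec zero    xs           = [] , z≤n
  runsF-spec (suc f) []           = [] , z≤n
  runsF-spec (suc f) (x ∷ [])     = s≤s z≤n ∷ [] , s≤s z≤n
  runsF-spec (suc f) (x ∷ y ∷ ys) with x ≼? y
  ... | yes _ = let nonEmpty , total = runsF-spec f (proj₂ (incr y ys))
                in s≤s z≤n ∷ nonEmpty , run∷rest-length≤ (incr-length y ys) total
  ... | no  _ = let nonEmpty , total = runsF-spec f (proj₂ (decr y ys))
                in s≤s z≤n ∷ nonEmpty , run∷rest-length≤ (decr-length y ys) total

  module _ (k' m : ℕ) where
    open Levels k' m

    position<N : ∀ {s Lp} → 1 ≤ Lp → Lp ≤ s → s ≤ n → 2 * s ∸ Lp < N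
    position<N {s} {Lp} 1≤Lp Lp≤s s≤n = begin-strict
      2 * s ∸ Lp        <⟨ m<m+n (2 * s ∸ Lp) 1≤Lp ⟩
      2 * s ∸ Lp + Lp   ≡⟨ m∸n+n≡m (≤-trans Lp≤s (m≤m+n s _)) ⟩
      2 * s             ≤⟨ *-monoʳ-≤ 2 s≤n ⟩
      N                 ∎
      where open ≤-Reasoning

    -- The point b_i of one boundary is the point a_{i+1} of the next.
    next-position : ∀ s Lc → 2 * (s + Lc) ∸ Lc ≡ 2 * s + Lc
    next-position s Lc = begin
      2 * (s + Lc) ∸ Lc         ≡⟨ cong (_∸ Lc) (*-distribˡ-+ 2 s Lc) ⟩
      2 * s + 2 * Lc ∸ Lc       ≡⟨ cong (λ t → 2 * s + t ∸ Lc) (cong (Lc +_) (+-identityʳ Lc)) ⟩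
      2 * s + (Lc + Lc) ∸ Lc    ≡⟨ cong (_∸ Lc) (sym (+-assoc (2 * s) Lc Lc)) ⟩
      2 * s + Lc + Lc ∸ Lc      ≡⟨ m+n∸n≡m (2 * s + Lc) Lc ⟩
      2 * s + Lc                ∎
      where open ≡-Reasoning

    stack-bounded : ∀ {S z} → StackInv (powers S) z → z < N → length S ≤ stackBound k n
    stack-bounded {S} inv z<N = subst (_≤ stackBound k n) (length-map proj₂ S) (StackInv⇒length≤ inv z<N)

    sublists-bounded : ∀ {S B} {Ts : List Stack} → length S ≤ B → All (_⊆ S) Ts → All (λ T → length T ≤ B) Ts
    sublists-bounded |S|≤B = All.map (λ T⊆S → ≤-trans (length-mono-≤ T⊆S) |S|≤B)

    push-spec : ∀ s S X Lp Lc → StackInv (powers S) (2 * s ∸ Lp) → 1 ≤ Lp → Lp ≤ s → 1 ≤ Lc →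
      let P = boundaryPower k n s Lp Lc
          (S' , X' , trace) = collapse (length S) P S X
      in All (_⊆ S) trace × StackInv (powers ((X' , P) ∷ S')) (2 * (s + Lc) ∸ Lc)
    push-spec s S X Lp Lc inv 1≤Lp Lp≤s 1≤Lc
      with S'⊆S , S'≤P , trace⊆S ← collapse-spec (length S) (boundaryPower k n s Lp Lc) S X ≤-refl (StackInv.sorted inv)
      = trace⊆S , subst (StackInv _) (sym (next-position s Lc))
                    (StackInv-push inv P≤C split (map⁺ proj₂ S'⊆S) S'≤P)
      where
      P : ℕ
      P = boundaryPower k n s Lp Lc
      spec : P ≤ C × FirstSplit (2 * s ∸ Lp) (2 * s + Lc) P
      spec = boundaryPower-spec s Lp Lc 1≤Lp (≤-trans Lp≤s (m≤m+n s _)) 1≤Lc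
      P≤C : P ≤ C
      P≤C = proj₁ spec
      split : FirstSplit (2 * s ∸ Lp) (2 * s + Lc) P
      split = proj₂ spec

    mainLoop-bounded : ∀ s S X Rprev rs →
      StackInv (powers S) (2 * s ∸ length Rprev) → 1 ≤ length Rprev → length Rprev ≤ s →
      s + sum (map length rs) ≤ n → All (λ R → 1 ≤ length R) rs →
      All (λ T → length T ≤ stackBound k n) (mainLoop k n s S X Rprev rs)
    mainLoop-bounded s S X Rprev [] inv 1≤Lp Lp≤s s≤n _ =
      sublists-bounded (stack-bounded inv (position<N 1≤Lp Lp≤s (subst (_≤ n) (+-identityʳ s) s≤n)))
        (finalPhase-⊆ k (length S) S X)
    mainLoop-bounded s S X Rprev (R ∷ rs) inv 1≤Lp Lp≤s s+|R∷rs|≤n (1≤Lc ∷ nonEmpty)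
      with trace⊆S , inv' ← push-spec s S X (length Rprev) (length R) inv 1≤Lp Lp≤s 1≤Lc
      = ++⁺ (sublists-bounded (stack-bounded inv (position<N 1≤Lp Lp≤s (≤-trans (m≤m+n s _) s+|R∷rs|≤n))) trace⊆S)
            (stack-bounded {S'} inv' (position<N 1≤Lc Lc≤s' s'≤n)
             ∷ mainLoop-bounded (s + length R) S' R R rs inv' 1≤Lc Lc≤s' s'+|rs|≤n nonEmpty)
      where
      P : ℕ
      P = boundaryPower k n s (length Rprev) (length R)
      col : Stack × List A × List Stack
      col = collapse (length S) P S X
      S' : Stack
      S' = (proj₁ (proj₂ col) , P) ∷ proj₁ col
      Lc≤s' : length R ≤ s + length R
      Lc≤s' = m≤n+m (length R) s
      s'+|rs|≤n : s + length R + sum (map length rs) ≤ n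
      s'+|rs|≤n = ≤-trans (≤-reflexive (+-assoc s (length R) _)) s+|R∷rs|≤n
      s'≤n : s + length R ≤ n
      s'≤n = ≤-trans (m≤m+n (s + length R) _) s'+|rs|≤n

proposition1 : ∀ {c ℓ₁ ℓ₂ : Level} (O : DecTotalOrder c ℓ₁ ℓ₂) (k : ℕ) → 2 ≤ k →
    (A : List (DecTotalOrder.Carrier O)) → 1 ≤ length A →
    All (λ S → length S ≤ stackBound k (length A)) (Powersort.stackTrace O k A)
proposition1 O (suc (suc k')) _ A@(a ∷ as) _
  with Powersort.runs O A | StackBehaviour.runsF-spec O (length A) A
... | []      | _                           = z≤n ∷ []
... | R₀ ∷ Rs | (1≤|R₀| ∷ nonEmpty) , total =
  z≤n ∷ StackBehaviour.mainLoop-bounded O k' (length as) (length R₀) [] R₀ R₀ Rs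
          (Levels.StackInv-[] k' (length as) _) 1≤|R₀| ≤-refl total nonEmpty
proposition1 O 1 (s≤s ()) _ _
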